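{- Let $G_1$ and $G_2$ be vertex-disjoint finite simple graphs and let $G=G_1+G_2$ be their join. Then $\alpha(F_2(G)) \geq \alpha(F_2(G_1))+\alpha(F_2(G_2))$.
   Context: For a finite simple graph $G$, the $2$-token graph $F_2(G)$ is the graph whose vertices are the $2$-element subsets of $V(G)$, two such subsets being adjacent if and only if their symmetric difference is an edge of $G$ (if $G$ has fewer than $2$ vertices, $F_2(G)$ has no vertices and its independence number is $0$). $\alpha(\cdot)$ denotes the independence number. The join $G_1+G_2$ of disjoint graphs $G_1,G_2$ has vertex set $V(G_1)\cup V(G_2)$ and edge set $E(G_1)\cup E(G_2)\cup\{uv : u\in V(G_1), v\in V(G_2)\}$. -}

module Defs where

open import Data.Nat using (ℕ; _+_; _≤_)
open import Data.Bool using (Bool; true; false; T)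
open import Data.Fin using (Fin; splitAt)
open import Data.Sum using (_⊎_; inj₁; inj₂)
open import Data.Product using (_×_; ∃; ∃-syntax)
open import Data.Fin.Subset using (Subset; _∈_; _∪_; _─_; ∣_∣)
open import Data.List using (List; length)
open import Data.List.Relation.Unary.All using (All)
open import Data.List.Relation.Unary.AllPairs using (AllPairs)
open import Relation.Binary.PropositionalEquality using (_≡_; _≢_)
open import Relation.Nullary using (¬_)
open import Function.Bundles using (_⇔_)

record SimpleGraph (n : ℕ) : Set where
  field
    adj    : Fin n → Fin n → Bool
    sym    : ∀ u v → adj u v ≡ adj v u
    irrefl : ∀ u → adj u u ≡ false

open SimpleGraph public

Edge : ∀ {n} → SimpleGraph n → Fin n → Fin n → Set
Edge G u v = T (adj G u v)

-- Join G₁ + G₂ on the disjoint union Fin (n₁ + n₂)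
-- (first n₁ vertices are those of G₁, the remaining n₂ those of G₂).
joinAdj : ∀ {n₁ n₂} → SimpleGraph n₁ → SimpleGraph n₂ →
          Fin n₁ ⊎ Fin n₂ → Fin n₁ ⊎ Fin n₂ → Bool
joinAdj G₁ G₂ (inj₁ a) (inj₁ b) = adj G₁ a b
joinAdj G₁ G₂ (inj₂ a) (inj₂ b) = adj G₂ a b
joinAdj G₁ G₂ (inj₁ a) (inj₂ b) = true
joinAdj G₁ G₂ (inj₂ a) (inj₁ b) = true

joinAdj-sym : ∀ {n₁ n₂} (G₁ : SimpleGraph n₁) (G₂ : SimpleGraph n₂) x y →
              joinAdj G₁ G₂ x y ≡ joinAdj G₁ G₂ y x
joinAdj-sym G₁ G₂ (inj₁ a) (inj₁ b) = sym G₁ a b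
joinAdj-sym G₁ G₂ (inj₂ a) (inj₂ b) = sym G₂ a b
joinAdj-sym G₁ G₂ (inj₁ a) (inj₂ b) = _≡_.refl
joinAdj-sym G₁ G₂ (inj₂ a) (inj₁ b) = _≡_.refl

joinAdj-irrefl : ∀ {n₁ n₂} (G₁ : SimpleGraph n₁) (G₂ : SimpleGraph n₂) x →
                 joinAdj G₁ G₂ x x ≡ false
joinAdj-irrefl G₁ G₂ (inj₁ a) = irrefl G₁ a
joinAdj-irrefl G₁ G₂ (inj₂ a) = irrefl G₂ a

join : ∀ {n₁ n₂} → SimpleGraph n₁ → SimpleGraph n₂ → SimpleGraph (n₁ + n₂)
join {n₁} G₁ G₂ = record
  { adj    = λ x y → joinAdj G₁ G₂ (splitAt n₁ x) (splitAt n₁ y)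
  ; sym    = λ x y → joinAdj-sym G₁ G₂ (splitAt n₁ x) (splitAt n₁ y)
  ; irrefl = λ x → joinAdj-irrefl G₁ G₂ (splitAt n₁ x)
  }

-- 2-token graph F₂(G): vertices are the 2-element subsets of V(G);
-- A ~ B iff the symmetric difference A △ B is (the vertex set of) an edge of G.
IsToken2 : ∀ {n} → Subset n → Set
IsToken2 A = ∣ A ∣ ≡ 2

_△_ : ∀ {n} → Subset n → Subset n → Subset n
A △ B = (A ─ B) ∪ (B ─ A)

Token2Adj : ∀ {n} → SimpleGraph n → Subset n → Subset n → Set
Token2Adj G A B =
  ∃[ u ] ∃[ v ] (Edge G u v × (∀ x → (x ∈ (A △ B)) ⇔ (x ≡ u ⊎ x ≡ v)))

-- An independent set of F₂(G), given as a duplicate-free list of its vertices,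
-- pairwise non-adjacent.
IsIndepF2 : ∀ {n} → SimpleGraph n → List (Subset n) → Set
IsIndepF2 G I =
  All IsToken2 I × AllPairs _≢_ I × AllPairs (λ A B → ¬ Token2Adj G A B) I

IsAlphaF2 : ∀ {n} → SimpleGraph n → ℕ → Set
IsAlphaF2 G k =
  (∃[ I ] (IsIndepF2 G I × length I ≡ k)) ×
  (∀ I → IsIndepF2 G I → length I ≤ k)

{-# OPTIONS --safe #-}
module Submission where

-- Read inside the copy of G₁ in the join, an independent set of F₂(G₁) stays
-- independent: the symmetric difference of two of its 2-sets lies in that
-- copy, on which the join induces G₁.  Likewise for G₂.  The two images are
-- disjoint and mutually non-adjacent: for 2-sets A ⊆ V(G₁) and B ⊆ V(G₂) the
-- symmetric difference A △ B = A ∪ B has four elements, so it is no edge.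

open import Defs hiding (sym)
open import Data.Nat using (ℕ; suc; _+_; _≤_)
open import Data.Nat.Properties using (suc-injective; +-identityʳ)
open import Data.Bool using (true; false; T)
open import Data.Fin using (Fin; zero; suc; splitAt; _↑ˡ_; _↑ʳ_)
import Data.Fin.Properties as Fin
open import Data.Fin.Properties using (↑ˡ-injective; ↑ʳ-injective; splitAt-↑ˡ; splitAt-↑ʳ)
open import Data.Fin.Subset using (Subset; _∈_; _⊆_; _─_; ∣_∣; ⊥; Nonempty)
open import Data.Fin.Subset.Properties using (∉⊥; ∣⊥∣≡0; ⊆-antisym; ∪-comm)
open import Data.Vec using ([]; _∷_; _++_; here; there)
open import Data.Vec.Properties using (++-injectiveˡ)
open import Data.Sum using (_⊎_; inj₁; inj₂)
open import Data.Sum.Function.Propositional using (_⊎-⇔_)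
open import Data.Product using (_×_; _,_; ∃; ∃-syntax; ∃₂; proj₁; proj₂)
open import Data.List using (List; length; map)
import Data.List as List
open import Data.List.Properties using (length-map; length-++)
open import Data.List.Relation.Unary.All using (All)
import Data.List.Relation.Unary.All as All
import Data.List.Relation.Unary.All.Properties as All
import Data.List.Relation.Unary.AllPairs as AllPairs
import Data.List.Relation.Unary.AllPairs.Properties as AllPairs
open import Relation.Binary.PropositionalEquality
open import Relation.Nullary using (¬_)
open import Function using (_∘_)
open import Function.Bundles using (_⇔_; mk⇔; Equivalence)
open import Function.Construct.Composition using (_⇔-∘_)
open import Function.Construct.Symmetry using (⇔-sym)
open import Function.Definitions using (Injective)
open import Data.Empty using (⊥-elim)

↑ˡ≢↑ʳ : ∀ {m n} (x : Fin m) (y : Fin n) → x ↑ˡ n ≢ m ↑ʳ y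
↑ˡ≢↑ʳ {m} {n} x y eq
  with trans (sym (splitAt-↑ˡ m x n)) (trans (cong (splitAt m) eq) (splitAt-↑ʳ m n y))
... | ()

∈-++⁺ˡ : ∀ {m n} {x : Fin m} {p : Subset m} (q : Subset n) → x ∈ p → x ↑ˡ n ∈ p ++ q
∈-++⁺ˡ q here      = here
∈-++⁺ˡ q (there x) = there (∈-++⁺ˡ q x)

∈-++⁻ˡ : ∀ {m n} {x : Fin m} (p : Subset m) {q : Subset n} → x ↑ˡ n ∈ p ++ q → x ∈ p
∈-++⁻ˡ {x = zero}  (_ ∷ p) here      = here
∈-++⁻ˡ {x = suc x} (_ ∷ p) (there i) = there (∈-++⁻ˡ p i)

∈-++⁺ʳ : ∀ {m n} {y : Fin n} (p : Subset m) {q : Subset n} → y ∈ q → m ↑ʳ y ∈ p ++ q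
∈-++⁺ʳ []      i = i
∈-++⁺ʳ (_ ∷ p) i = there (∈-++⁺ʳ p i)

∈-++⁻ʳ : ∀ {m n} {y : Fin n} (p : Subset m) {q : Subset n} → m ↑ʳ y ∈ p ++ q → y ∈ q
∈-++⁻ʳ []      i         = i
∈-++⁻ʳ (_ ∷ p) (there i) = ∈-++⁻ʳ p i

∈p++⊥⇒∃↑ˡ : ∀ {m n} {z : Fin (m + n)} (p : Subset m) → z ∈ p ++ ⊥ → ∃ λ x → z ≡ x ↑ˡ n
∈p++⊥⇒∃↑ˡ []      z∈⊥       = ⊥-elim (∉⊥ z∈⊥)
∈p++⊥⇒∃↑ˡ (_ ∷ p) here      = zero , refl
∈p++⊥⇒∃↑ˡ (_ ∷ p) (there i) with ∈p++⊥⇒∃↑ˡ p i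
... | x , refl = suc x , refl

∈⊥++q⇒∃↑ʳ : ∀ m {n} {z : Fin (m + n)} {q : Subset n} → z ∈ ⊥ ++ q → ∃ λ y → z ≡ m ↑ʳ y
∈⊥++q⇒∃↑ʳ 0       _         = _ , refl
∈⊥++q⇒∃↑ʳ (suc m) (there i) with ∈⊥++q⇒∃↑ʳ m i
... | y , refl = y , refl

∣p++q∣≡∣p∣+∣q∣ : ∀ {m n} (p : Subset m) (q : Subset n) → ∣ p ++ q ∣ ≡ ∣ p ∣ + ∣ q ∣
∣p++q∣≡∣p∣+∣q∣ []          q = refl
∣p++q∣≡∣p∣+∣q∣ (true  ∷ p) q = cong suc (∣p++q∣≡∣p∣+∣q∣ p q)
∣p++q∣≡∣p∣+∣q∣ (false ∷ p) q = ∣p++q∣≡∣p∣+∣q∣ p q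

∣p∣≡1+k⇒Nonempty : ∀ {n k} (p : Subset n) → ∣ p ∣ ≡ suc k → Nonempty p
∣p∣≡1+k⇒Nonempty (true  ∷ p) _ = zero , here
∣p∣≡1+k⇒Nonempty (false ∷ p) eq with ∣p∣≡1+k⇒Nonempty p eq
... | x , x∈p = suc x , there x∈p

∣p∣≡2+k⇒two-elements : ∀ {n k} (p : Subset n) → ∣ p ∣ ≡ suc (suc k) →
                       ∃₂ λ x y → x ≢ y × x ∈ p × y ∈ p
∣p∣≡2+k⇒two-elements (true ∷ p) eq with ∣p∣≡1+k⇒Nonempty p (suc-injective eq)
... | y , y∈p = zero , suc y , (λ ()) , here , there y∈p
∣p∣≡2+k⇒two-elements (false ∷ p) eq with ∣p∣≡2+k⇒two-elements p eq
... | x , y , x≢y , x∈p , y∈p =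
  suc x , suc y , x≢y ∘ Fin.suc-injective , there x∈p , there y∈p

△-comm : ∀ {n} (p q : Subset n) → p △ q ≡ q △ p
△-comm p q = ∪-comm (p ─ q) (q ─ p)

p△⊥≡p : ∀ {n} (p : Subset n) → p △ ⊥ ≡ p
p△⊥≡p []          = refl
p△⊥≡p (true  ∷ p) = cong (true ∷_) (p△⊥≡p p)
p△⊥≡p (false ∷ p) = cong (false ∷_) (p△⊥≡p p)

⊥△p≡p : ∀ {n} (p : Subset n) → ⊥ △ p ≡ p
⊥△p≡p p = trans (△-comm ⊥ p) (p△⊥≡p p)

++-△ : ∀ {m n} (p p′ : Subset m) (q q′ : Subset n) →
       (p ++ q) △ (p′ ++ q′) ≡ (p △ p′) ++ (q △ q′)
++-△ []      []       q q′ = refl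
++-△ (_ ∷ p) (_ ∷ p′) q q′ = cong (_ ∷_) (++-△ p p′ q q′)

pigeonhole : ∀ {a} {A : Set a} {u v x y z : A} →
             x ≡ u ⊎ x ≡ v → y ≡ u ⊎ y ≡ v → z ≡ u ⊎ z ≡ v →
             x ≡ y ⊎ x ≡ z ⊎ y ≡ z
pigeonhole (inj₁ refl) (inj₁ refl) _           = inj₁ refl
pigeonhole (inj₂ refl) (inj₂ refl) _           = inj₁ refl
pigeonhole (inj₁ refl) _           (inj₁ refl) = inj₂ (inj₁ refl)
pigeonhole (inj₂ refl) _           (inj₂ refl) = inj₂ (inj₁ refl)
pigeonhole _           (inj₁ refl) (inj₁ refl) = inj₂ (inj₂ refl)
pigeonhole _           (inj₂ refl) (inj₂ refl) = inj₂ (inj₂ refl)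

IsEdge : ∀ {n} → SimpleGraph n → Subset n → Set
IsEdge G S = ∃[ u ] ∃[ v ] (Edge G u v × (∀ x → x ∈ S ⇔ (x ≡ u ⊎ x ≡ v)))

++⊥≢⊥++ : ∀ {m n} {A : Subset m} {B : Subset n} → IsToken2 A → A ++ ⊥ ≢ ⊥ ++ B
++⊥≢⊥++ {m} {A = A} A-token eq
  with trans (sym A-token) (trans (cong ∣_∣ (++-injectiveˡ A ⊥ eq)) (∣⊥∣≡0 m))
... | ()

¬IsEdge-++ : ∀ {m n j k} {G : SimpleGraph (m + n)} (A : Subset m) (B : Subset n) →
             ∣ A ∣ ≡ 2 + j → ∣ B ∣ ≡ 1 + k → ¬ IsEdge G (A ++ B)
¬IsEdge-++ A B ∣A∣≡2+j ∣B∣≡1+k (u , v , _ , A++B⇔uv)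
  with ∣p∣≡2+k⇒two-elements A ∣A∣≡2+j | ∣p∣≡1+k⇒Nonempty B ∣B∣≡1+k
... | x₁ , x₂ , x₁≢x₂ , x₁∈A , x₂∈A | y , y∈B
  with pigeonhole (Equivalence.to (A++B⇔uv _) (∈-++⁺ˡ B x₁∈A))
                  (Equivalence.to (A++B⇔uv _) (∈-++⁺ˡ B x₂∈A))
                  (Equivalence.to (A++B⇔uv _) (∈-++⁺ʳ A y∈B))
... | inj₁ eq        = x₁≢x₂ (↑ˡ-injective _ x₁ x₂ eq)
... | inj₂ (inj₁ eq) = ↑ˡ≢↑ʳ x₁ y eq
... | inj₂ (inj₂ eq) = ↑ˡ≢↑ʳ x₂ y eq

IsIndepF2-++ : ∀ {n} {G : SimpleGraph n} {J₁ J₂ : List (Subset n)} →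
               IsIndepF2 G J₁ → IsIndepF2 G J₂ →
               All (λ X → All (λ Y → X ≢ Y × ¬ Token2Adj G X Y) J₂) J₁ →
               IsIndepF2 G (J₁ List.++ J₂)
IsIndepF2-++ (t₁ , d₁ , i₁) (t₂ , d₂ , i₂) separated =
    All.++⁺ t₁ t₂
  , AllPairs.++⁺ d₁ d₂ (All.map (proj₁ ∘ All.unzip) separated)
  , AllPairs.++⁺ i₁ i₂ (All.map (proj₂ ∘ All.unzip) separated)

record EdgeReflectingEmbedding {k N} (H : SimpleGraph k) (G : SimpleGraph N) : Set where
  field
    vertex           : Fin k → Fin N
    vertex-injective : Injective _≡_ _≡_ vertex
    edge-reflect     : ∀ {u v} → Edge G (vertex u) (vertex v) → Edge H u v
    image            : Subset k → Subset N
    ∈-image⁺         : ∀ {S x} → x ∈ S → vertex x ∈ image S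
    ∈-image⁻         : ∀ {S x} → vertex x ∈ image S → x ∈ S
    image⊆range      : ∀ {S z} → z ∈ image S → ∃ λ x → z ≡ vertex x
    image-△          : ∀ A B → image A △ image B ≡ image (A △ B)
    ∣image∣          : ∀ A → ∣ image A ∣ ≡ ∣ A ∣

  ∈-image⇔ : ∀ {S x} → vertex x ∈ image S ⇔ x ∈ S
  ∈-image⇔ = mk⇔ ∈-image⁻ ∈-image⁺

  vertex≡⇔ : ∀ {x y} → vertex x ≡ vertex y ⇔ x ≡ y
  vertex≡⇔ = mk⇔ vertex-injective (cong vertex)

  image-injective : Injective _≡_ _≡_ image
  image-injective eq = ⊆-antisym (image≡⇒⊆ eq) (image≡⇒⊆ (sym eq))
    where
    image≡⇒⊆ : ∀ {A B} → image A ≡ image B → A ⊆ B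
    image≡⇒⊆ eq {x} x∈A = ∈-image⁻ (subst (vertex x ∈_) eq (∈-image⁺ x∈A))

  IsEdge-reflect : ∀ {S} → IsEdge G (image S) → IsEdge H S
  IsEdge-reflect (u , v , uv , image⇔uv)
    with image⊆range (Equivalence.from (image⇔uv u) (inj₁ refl))
       | image⊆range (Equivalence.from (image⇔uv v) (inj₂ refl))
  ... | u′ , refl | v′ , refl =
    u′ , v′ , edge-reflect uv ,
    λ x → (vertex≡⇔ ⊎-⇔ vertex≡⇔) ⇔-∘ (image⇔uv (vertex x) ⇔-∘ ⇔-sym ∈-image⇔)

  Token2Adj-reflect : ∀ {A B} → Token2Adj G (image A) (image B) → Token2Adj H A B
  Token2Adj-reflect {A} {B} = IsEdge-reflect ∘ subst (IsEdge G) (image-△ A B)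

  IsIndepF2-map : ∀ {I} → IsIndepF2 H I → IsIndepF2 G (map image I)
  IsIndepF2-map (tokens , distinct , independent) =
      All.map⁺ (All.map (trans (∣image∣ _)) tokens)
    , AllPairs.map⁺ (AllPairs.map (_∘ image-injective) distinct)
    , AllPairs.map⁺ (AllPairs.map (_∘ Token2Adj-reflect) independent)

open EdgeReflectingEmbedding using (IsIndepF2-map)

module _ {m n} (G₁ : SimpleGraph m) (G₂ : SimpleGraph n) where

  join-embedˡ : EdgeReflectingEmbedding G₁ (join G₁ G₂)
  join-embedˡ = record
    { vertex           = _↑ˡ n
    ; vertex-injective = ↑ˡ-injective n _ _
    ; edge-reflect     = λ {u v} → subst₂ (λ a b → T (joinAdj G₁ G₂ a b))
                                          (splitAt-↑ˡ m u n) (splitAt-↑ˡ m v n)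
    ; image            = _++ ⊥
    ; ∈-image⁺         = ∈-++⁺ˡ ⊥
    ; ∈-image⁻         = λ {S} → ∈-++⁻ˡ S
    ; image⊆range      = λ {S} → ∈p++⊥⇒∃↑ˡ S
    ; image-△          = λ A B → trans (++-△ A B ⊥ ⊥) (cong ((A △ B) ++_) (p△⊥≡p ⊥))
    ; ∣image∣          = λ A → trans (∣p++q∣≡∣p∣+∣q∣ A ⊥)
                                     (trans (cong (∣ A ∣ +_) (∣⊥∣≡0 n)) (+-identityʳ ∣ A ∣))
    }

  join-embedʳ : EdgeReflectingEmbedding G₂ (join G₁ G₂)
  join-embedʳ = record
    { vertex           = m ↑ʳ_
    ; vertex-injective = ↑ʳ-injective m _ _
    ; edge-reflect     = λ {u v} → subst₂ (λ a b → T (joinAdj G₁ G₂ a b))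
                                          (splitAt-↑ʳ m n u) (splitAt-↑ʳ m n v)
    ; image            = ⊥ ++_
    ; ∈-image⁺         = ∈-++⁺ʳ ⊥
    ; ∈-image⁻         = ∈-++⁻ʳ ⊥
    ; image⊆range      = ∈⊥++q⇒∃↑ʳ m
    ; image-△          = λ A B → trans (++-△ ⊥ ⊥ A B) (cong (_++ (A △ B)) (p△⊥≡p ⊥))
    ; ∣image∣          = λ B → trans (∣p++q∣≡∣p∣+∣q∣ (⊥ {m}) B) (cong (_+ ∣ B ∣) (∣⊥∣≡0 m))
    }

  ¬Token2Adj-++⊥-⊥++ : ∀ {A : Subset m} {B : Subset n} → IsToken2 A → IsToken2 B →
                       ¬ Token2Adj (join G₁ G₂) (A ++ ⊥) (⊥ ++ B)
  ¬Token2Adj-++⊥-⊥++ {A} {B} A-token B-token =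
    ¬IsEdge-++ {G = join G₁ G₂} A B A-token B-token
      ∘ subst (IsEdge (join G₁ G₂)) A++⊥△⊥++B≡A++B
    where
    A++⊥△⊥++B≡A++B : (A ++ ⊥) △ (⊥ ++ B) ≡ A ++ B
    A++⊥△⊥++B≡A++B = trans (++-△ A ⊥ ⊥ B) (cong₂ _++_ (p△⊥≡p A) (⊥△p≡p B))

  join-IsIndepF2 : ∀ {I₁ I₂} → IsIndepF2 G₁ I₁ → IsIndepF2 G₂ I₂ →
                   IsIndepF2 (join G₁ G₂) (map (_++ ⊥) I₁ List.++ map (⊥ ++_) I₂)
  join-IsIndepF2 indep₁@(tokens₁ , _) indep₂@(tokens₂ , _) =
    IsIndepF2-++ {G = join G₁ G₂}
      (IsIndepF2-map join-embedˡ indep₁)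
      (IsIndepF2-map join-embedʳ indep₂)
      (All.map⁺ (All.map (λ A-token → All.map⁺ (All.map (λ B-token →
        ++⊥≢⊥++ {n = n} A-token , ¬Token2Adj-++⊥-⊥++ A-token B-token) tokens₂)) tokens₁))

proposition2 : ∀ {n₁ n₂} (G₁ : SimpleGraph n₁) (G₂ : SimpleGraph n₂)
                 (a₁ a₂ a : ℕ) →
                 IsAlphaF2 G₁ a₁ → IsAlphaF2 G₂ a₂ → IsAlphaF2 (join G₁ G₂) a →
                 a₁ + a₂ ≤ a
proposition2 G₁ G₂ _ _ a ((I₁ , indep₁ , refl) , _) ((I₂ , indep₂ , refl) , _) (_ , maximum) =
  subst (_≤ a) length-union (maximum _ (join-IsIndepF2 G₁ G₂ indep₁ indep₂))
  where
  length-union : length (map (_++ ⊥) I₁ List.++ map (⊥ ++_) I₂) ≡ length I₁ + length I₂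
  length-union =
    trans (length-++ (map (_++ ⊥) I₁)) (cong₂ _+_ (length-map _ I₁) (length-map _ I₂))
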